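{- Let $N\ge1$ be an integer with $N\geq \max_{1\leq a\leq b-1} \big(N_{a,A}+N_{b-a,b-A}\big)$. If $n$ is an integer with $0 \leq n\leq Nb$ and $n\notin \mathcal E(A)\cup (Nb- \mathcal E(b-A))$, then $n\in NA$.
   Context: $A$ is a finite set of integers with smallest element $0$, largest element $b\ge1$, and gcd of its elements equal to $1$. $\mathbb N=\{0,1,2,\dots\}$. For an integer $N\ge1$, $NA=\{a_1+\cdots+a_N:a_i\in A\}$ (repetitions allowed), and $0A=\{0\}$. For a finite set $X$ of nonnegative integers, $\mathcal P(X)=\{\sum_{x\in X} n_x x: n_x\in\mathbb N\}$ and $\mathcal E(X)=\mathbb N\setminus\mathcal P(X)$. $b-A=\{b-x:x\in A\}$; $m-Y=\{m-y:y\in Y\}$. For an integer $c$, $n_{c,A}=\min\{n\ge 0: n\equiv c\pmod b,\ n\in\mathcal P(A)\}$ and $N_{c,A}=\min\{N\ge0: n_{c,A}\in NA\}$; $N_{c,b-A}$ is defined likewise with $b-A$ in place of $A$ (same modulus $b$). -}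

module Defs where

open import Data.Nat using (ℕ; zero; suc; _+_; _*_; _∸_; _≤_; _<_)
open import Data.Nat.GCD using (gcd)
open import Data.Integer as ℤ using (ℤ; +_; _-_)
open import Data.Integer.Divisibility using (_∣_)
open import Data.List using (List; length; foldr; map; lookup)
open import Data.List.Membership.Propositional using (_∈_)
open import Data.Vec using (Vec)
open import Data.Vec.Relation.Unary.All using (All)
open import Data.Fin using (Fin)
open import Data.Product using (Σ; _×_; ∃)
open import Relation.Binary.PropositionalEquality using (_≡_)
open import Relation.Nullary using (¬_)

ΣFin : (n : ℕ) → (Fin n → ℕ) → ℕ
ΣFin zero    f = 0
ΣFin (suc n) f = f Fin.zero + ΣFin n (λ i → f (Fin.suc i))

vsum : {n : ℕ} → Vec ℕ n → ℕ
vsum Vec.[] = 0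
vsum (x Vec.∷ xs) = x + vsum xs

gcdList : List ℕ → ℕ
gcdList = foldr gcd 0

ModEq : ℕ → ℕ → ℕ → Set
ModEq b x y = (+ b) ∣ ((+ x) - (+ y))

-- n ∈ N A : n = a₁ + ⋯ + a_N with each aᵢ ∈ A  (0A = {0})
InSumset : ℕ → List ℕ → ℕ → Set
InSumset N A n = Σ (Vec ℕ N) λ v → All (_∈ A) v × vsum v ≡ n

-- n ∈ 𝒫(X) : n = Σ_{x ∈ X} n_x x with n_x ∈ ℕ
InP : List ℕ → ℕ → Set
InP X n = Σ (Fin (length X) → ℕ) λ c → ΣFin (length X) (λ i → c i * lookup X i) ≡ n

InE : List ℕ → ℕ → Set
InE X n = ¬ InP X n

reflectList : ℕ → List ℕ → List ℕ
reflectList b X = map (b ∸_) X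

IsNmin : List ℕ → ℕ → ℕ → ℕ → Set
IsNmin A b c m =
  ModEq b m c × InP A m × (∀ m' → m' < m → ModEq b m' c → ¬ InP A m')

IsNcount : List ℕ → ℕ → ℕ → ℕ → Set
IsNcount A b c K =
  Σ ℕ λ m → IsNmin A b c m × InSumset K A m × (∀ K' → K' < K → ¬ InSumset K' A m)

-- A is a finite set of integers with min 0, max b ≥ 1, and gcd 1
-- (given as a list; duplicates are harmless)
Admissible : List ℕ → ℕ → Set
Admissible A b =
  1 ≤ b × 0 ∈ A × b ∈ A × (∀ {x} → x ∈ A → x ≤ b) × gcdList A ≡ 1

{-# OPTIONS --safe #-}
module Submission where

-- Write n ≡ a (mod b) with 0 ≤ a < b; for a = 0, n = qb with q ≤ N lies in NA. Otherwise
-- n = n_{a,A} + k b and e = Nb − n = n_{b−a,b−A} + k′ b, and n + e = Nb forces k + k′ ≤ N.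
-- With N_{a,A} + N_{b−a,b−A} ≤ N this gives N_{a,A} + k ≤ N, so that adding k copies of b to
-- n_{a,A} puts n in NA, or N_{b−a,b−A} + k′ ≤ N, so that reflecting n_{b−a,b−A} through
-- x ↦ b − x and adding copies of b puts Nb − e = n in NA. Membership in NA is decidable, so it
-- suffices to argue under double negation, where the minima n_{c,A} and N_{c,A} are available.

open import Defs
open import Data.Nat using (ℕ; zero; suc; _+_; _*_; _∸_; _≤_; _<_; z≤n; s≤s; _≟_; _≤?_; NonZero; >-nonZero)
open import Data.Nat.Properties
open import Algebra.Properties.CommutativeSemigroup +-commutativeSemigroup using (interchange)
open import Data.Nat.DivMod using (_%_; _/_; m≡m%n+[m/n]*n; m%n<n)
open import Data.Nat.Divisibility as ℕ using (divides)
open import Data.Nat.Induction using (<-rec)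
open import Data.Nat.Tactic.RingSolver as ℕ-Ring using ()
open import Data.Integer as ℤ using (∣_∣)
open import Data.Integer.Properties using (m-n≡m⊖n; ⊖-≥; pos-+)
open import Data.Integer.Divisibility.Signed using (_∣_; ∣ᵤ⇒∣; ∣⇒∣ᵤ; ∣-refl; ∣m∣n⇒∣m+n; ∣m∣n⇒∣m-n; ∣m⇒∣-m)
open import Data.Integer.Tactic.RingSolver as ℤ-Ring using ()
open import Data.List using (List; []; _∷_)
open import Data.List.Membership.Propositional using (_∈_; find; lose)
open import Data.List.Membership.Propositional.Properties using (∈-map⁻)
open import Data.List.Relation.Unary.Any using (here; there; any?)
open import Data.Vec using (Vec; []; _∷_; _++_)
open import Data.Vec.Relation.Unary.All as All using ([]; _∷_)
open import Data.Vec.Relation.Unary.All.Properties using (++⁺)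
open import Data.Fin using (Fin)
open import Data.Product using (Σ; _×_; _,_; ∃; ∃-syntax)
open import Data.Sum using (_⊎_; inj₁; inj₂)
open import Effect.Monad using (RawMonad)
open import Function using (_∘_)
open import Level using (0ℓ)
open import Relation.Binary.PropositionalEquality
open import Relation.Nullary using (¬_; Dec; yes; no; contradiction)
open import Relation.Nullary.Decidable using (decidable-stable; _×-dec_)
open import Relation.Nullary.Negation using (¬¬-Monad)

open RawMonad (¬¬-Monad {0ℓ}) using (_>>=_; pure)

private
  variable
    A : List ℕ
    a b c k K K′ L N m m′ n x y : ℕ

vsum-++ : ∀ {k l} (u : Vec ℕ k) (v : Vec ℕ l) → vsum (u ++ v) ≡ vsum u + vsum v
vsum-++ []      v = refl
vsum-++ (x ∷ u) v = trans (cong (x +_) (vsum-++ u v)) (sym (+-assoc x (vsum u) (vsum v)))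

InSumset-+ : InSumset K A x → InSumset L A y → InSumset (K + L) A (x + y)
InSumset-+ (u , u∈A , refl) (v , v∈A , refl) = u ++ v , ++⁺ u∈A v∈A , vsum-++ u v

InSumset-* : x ∈ A → ∀ k → InSumset k A (k * x)
InSumset-* x∈A zero    = [] , [] , refl
InSumset-* {x = x} x∈A (suc k) with InSumset-* x∈A k
... | v , v∈A , eq = x ∷ v , x∈A ∷ v∈A , cong (x +_) eq

InSumset-mono : 0 ∈ A → K ≤ N → InSumset K A x → InSumset N A x
InSumset-mono {A = A} {K} {N} {x} 0∈A K≤N x∈KA =
  subst₂ (λ M y → InSumset M A y) (m+[n∸m]≡n K≤N) (+-identityʳ x)
    (subst (λ y → InSumset (K + (N ∸ K)) A (x + y)) (*-zeroʳ (N ∸ K))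
      (InSumset-+ x∈KA (InSumset-* 0∈A (N ∸ K))))

InSumset-∷ : InSumset K A m → InSumset K (x ∷ A) m
InSumset-∷ (v , v∈A , eq) = v , All.map there v∈A , eq

InP⇒InSumset : ∀ X → InP X m → ∃[ K ] InSumset K X m
InP⇒InSumset []      (c , eq) = 0 , [] , [] , eq
InP⇒InSumset (x ∷ X) (c , eq) with InP⇒InSumset X (c ∘ Fin.suc , refl)
... | K , rest = c Fin.zero + K ,
  subst (InSumset _ _) eq (InSumset-+ (InSumset-* (here refl) (c Fin.zero)) (InSumset-∷ rest))

InSumset-dec : ∀ A K n → Dec (InSumset K A n)
InSumset-dec A zero n with n ≟ 0
... | yes refl = yes ([] , [] , refl)
... | no n≢0   = no λ { ([] , [] , eq) → n≢0 (sym eq) }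
InSumset-dec A (suc K) n with any? (λ x → (x ≤? n) ×-dec InSumset-dec A K (n ∸ x)) A
... | yes some with find some
...   | x , x∈A , x≤n , (v , v∈A , eq) =
  yes (x ∷ v , x∈A ∷ v∈A , trans (cong (x +_) eq) (m+[n∸m]≡n x≤n))
InSumset-dec A (suc K) n | no none = no λ { (x ∷ v , x∈A ∷ v∈A , refl) →
  none (lose x∈A (m≤m+n x (vsum v) , v , v∈A , sym (m+n∸m≡n x (vsum v)))) }

InSumset-reflect : (∀ {x} → x ∈ A → x ≤ b) → InSumset K (reflectList b A) m →
                   ∃[ s ] InSumset K A s × m + s ≡ K * b
InSumset-reflect A≤b ([] , [] , refl) = 0 , ([] , [] , refl) , refl
InSumset-reflect {b = b} {suc K} A≤b (y ∷ v , y∈b-A ∷ v∈b-A , refl)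
  with ∈-map⁻ (b ∸_) y∈b-A | InSumset-reflect A≤b (v , v∈b-A , refl)
... | x , x∈A , refl | s , (w , w∈A , refl) , vsum+s≡Kb =
  x + s , (x ∷ w , x∈A ∷ w∈A , refl) , (begin
    (b ∸ x + vsum v) + (x + vsum w) ≡⟨ interchange (b ∸ x) (vsum v) x (vsum w) ⟩
    (b ∸ x + x) + (vsum v + vsum w) ≡⟨ cong₂ _+_ (m∸n+n≡m (A≤b x∈A)) vsum+s≡Kb ⟩
    b + K * b                       ∎)
  where open ≡-Reasoning

ModEq⇒∣ : ∀ x y → ModEq b x y → ℤ.+ b ∣ (ℤ.+ x ℤ.- ℤ.+ y)
ModEq⇒∣ x y = ∣ᵤ⇒∣ {i = ℤ.+ x ℤ.- ℤ.+ y}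

∣⇒ModEq : ∀ x y → ℤ.+ b ∣ (ℤ.+ x ℤ.- ℤ.+ y) → ModEq b x y
∣⇒ModEq x y = ∣⇒∣ᵤ {i = ℤ.+ x ℤ.- ℤ.+ y}

ModEq-sym : ModEq b x y → ModEq b y x
ModEq-sym {b} {x} {y} x≡y =
  ∣⇒ModEq y x (subst (ℤ.+ b ∣_) (neg-difference (ℤ.+ x) (ℤ.+ y)) (∣m⇒∣-m (ModEq⇒∣ x y x≡y)))
  where
  neg-difference : ∀ i j → ℤ.- (i ℤ.- j) ≡ j ℤ.- i
  neg-difference = ℤ-Ring.solve-∀

ModEq-trans : ModEq b x y → ModEq b y m → ModEq b x m
ModEq-trans {b} {x} {y} {m} x≡y y≡m =
  ∣⇒ModEq x m (subst (ℤ.+ b ∣_) (telescope (ℤ.+ x) (ℤ.+ y) (ℤ.+ m))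
    (∣m∣n⇒∣m+n (ModEq⇒∣ x y x≡y) (ModEq⇒∣ y m y≡m)))
  where
  telescope : ∀ i j l → (i ℤ.- j) ℤ.+ (j ℤ.- l) ≡ i ℤ.- l
  telescope = ℤ-Ring.solve-∀

∣+m-+n∣≡m∸n : n ≤ m → ∣ ℤ.+ m ℤ.- ℤ.+ n ∣ ≡ m ∸ n
∣+m-+n∣≡m∸n {n} {m} n≤m = cong ∣_∣ (trans (m-n≡m⊖n m n) (⊖-≥ n≤m))

ModEq-+* : ∀ m k → ModEq b (m + k * b) m
ModEq-+* {b} m k =
  subst (b ℕ.∣_) (sym (trans (∣+m-+n∣≡m∸n (m≤m+n m (k * b))) (m+n∸m≡n m (k * b)))) (divides k refl)

ModEq⇒≡+* : m ≤ n → ModEq b n m → ∃[ k ] n ≡ m + k * b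
ModEq⇒≡+* {m} {n} {b} m≤n n≡m with subst (b ℕ.∣_) (∣+m-+n∣≡m∸n m≤n) n≡m
... | divides k n∸m≡kb = k , trans (sym (m+[n∸m]≡n m≤n)) (cong (m +_) n∸m≡kb)

ModEq-complement : ∀ N → a ≤ b → n ≤ N * b → ModEq b n a → ModEq b (N * b ∸ n) (b ∸ a)
ModEq-complement {a} {b} {n} N a≤b n≤Nb n≡a =
  ∣⇒ModEq e d (subst (ℤ.+ b ∣_) difference (∣m∣n⇒∣m-n (∣m∣n⇒∣m-n b∣Nb ∣-refl) (ModEq⇒∣ n a n≡a)))
  where
  open ≡-Reasoning
  e d : ℕ
  e = N * b ∸ n
  d = b ∸ a
  b∣Nb : ℤ.+ b ∣ ℤ.+ (N * b)
  b∣Nb = ∣ᵤ⇒∣ {i = ℤ.+ (N * b)} (divides N refl)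
  rearrange : ∀ i j u v → ((i ℤ.+ j) ℤ.- (u ℤ.+ v)) ℤ.- (i ℤ.- u) ≡ j ℤ.- v
  rearrange = ℤ-Ring.solve-∀
  difference : (ℤ.+ (N * b) ℤ.- ℤ.+ b) ℤ.- (ℤ.+ n ℤ.- ℤ.+ a) ≡ ℤ.+ e ℤ.- ℤ.+ d
  difference = begin
    (ℤ.+ (N * b) ℤ.- ℤ.+ b) ℤ.- (ℤ.+ n ℤ.- ℤ.+ a)
      ≡⟨ cong₂ (λ u v → (ℤ.+ u ℤ.- ℤ.+ v) ℤ.- (ℤ.+ n ℤ.- ℤ.+ a))
               (sym (m+[n∸m]≡n n≤Nb)) (sym (m+[n∸m]≡n a≤b)) ⟩
    (ℤ.+ (n + e) ℤ.- ℤ.+ (a + d)) ℤ.- (ℤ.+ n ℤ.- ℤ.+ a)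
      ≡⟨ cong₂ (λ u v → (u ℤ.- v) ℤ.- (ℤ.+ n ℤ.- ℤ.+ a)) (pos-+ n e) (pos-+ a d) ⟩
    ((ℤ.+ n ℤ.+ ℤ.+ e) ℤ.- (ℤ.+ a ℤ.+ ℤ.+ d)) ℤ.- (ℤ.+ n ℤ.- ℤ.+ a)
      ≡⟨ rearrange (ℤ.+ n) (ℤ.+ e) (ℤ.+ a) (ℤ.+ d) ⟩
    ℤ.+ e ℤ.- ℤ.+ d
      ∎

ModEq-% : .{{_ : NonZero b}} → ∀ n → ModEq b n (n % b)
ModEq-% {b} n = subst (λ x → ModEq b x (n % b)) (sym (m≡m%n+[m/n]*n n b)) (ModEq-+* (n % b) (n / b))

¬¬-least : (P : ℕ → Set) → P n → ¬ ¬ (∃[ m ] P m × (∀ m′ → m′ < m → ¬ P m′))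
¬¬-least {n} P Pn no-least =
  <-rec (λ m → ¬ P m) (λ m below Pm → no-least (m , Pm , λ m′ m′<m → below m′<m)) n Pn

IsNmin-≤ : IsNmin A b c m → ModEq b n c → InP A n → m ≤ n
IsNmin-≤ (_ , _ , least) n≡c n∈P = ≮⇒≥ (λ n<m → least _ n<m n≡c n∈P)

IsNmin⇒≡+* : ∀ A c → IsNmin A b c m → ModEq b n c → InP A n → ∃[ k ] n ≡ m + k * b
IsNmin⇒≡+* {m = m} {n = n} A c m-min@(m≡c , _) n≡c n∈P =
  ModEq⇒≡+* (IsNmin-≤ {A = A} {c = c} m-min n≡c n∈P)
    (ModEq-trans {x = n} {y = c} {m = m} n≡c (ModEq-sym {x = m} {y = c} m≡c))

¬¬-IsNcount : ∀ A c → ModEq b n c → InP A n → ¬ ¬ ∃ (IsNcount A b c)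
¬¬-IsNcount {b} A c n≡c n∈P = do
  (m , (m≡c , m∈P) , m-least) ← ¬¬-least (λ m → ModEq b m c × InP A m) (n≡c , n∈P)
  let (K₀ , m∈K₀A) = InP⇒InSumset A m∈P
  (K , m∈KA , K-least) ← ¬¬-least (λ K → InSumset K A m) m∈K₀A
  pure (K , m , (m≡c , m∈P , λ m′ m′<m m′≡c m′∈P → m-least m′ m′<m (m′≡c , m′∈P)) , m∈KA , K-least)

m+n≤o⇒p+q≤o⇒m+p≤o⊎n+q≤o : ∀ {m n o p q} → m + n ≤ o → p + q ≤ o → m + p ≤ o ⊎ n + q ≤ o
m+n≤o⇒p+q≤o⇒m+p≤o⊎n+q≤o {m} {n} {o} {p} {q} m+n≤o p+q≤o with m + p ≤? o | n + q ≤? o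
... | yes m+p≤o | _         = inj₁ m+p≤o
... | no  _     | yes n+q≤o = inj₂ n+q≤o
... | no  m+p≰o | no  n+q≰o = contradiction (+-mono-≤ m+n≤o p+q≤o) (<⇒≱ (begin-strict
  o + o             <⟨ +-mono-< (≰⇒> m+p≰o) (≰⇒> n+q≰o) ⟩
  (m + p) + (n + q) ≡⟨ interchange m p n q ⟩
  (m + n) + (p + q) ∎))
  where open ≤-Reasoning

InSumset-+b* : 0 ∈ A → b ∈ A → InSumset K A m → K + k ≤ N → InSumset N A (m + k * b)
InSumset-+b* {k = k} 0∈A b∈A m∈KA K+k≤N =
  InSumset-mono 0∈A K+k≤N (InSumset-+ m∈KA (InSumset-* b∈A k))

InSumset-complement : 0 ∈ A → b ∈ A → (∀ {x} → x ∈ A → x ≤ b) →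
                      InSumset K (reflectList b A) m → K + k ≤ N → n + (m + k * b) ≡ N * b →
                      InSumset N A n
InSumset-complement {A = A} {b = b} {K = K} {m = m} {k = k} {N = N} {n = n}
                    0∈A b∈A A≤b m∈K[b-A] K+k≤N n+m+kb≡Nb
  with InSumset-reflect A≤b m∈K[b-A]
... | s , s∈KA , m+s≡Kb = subst (InSumset N A) (sym n≡s+rb) (InSumset-+b* 0∈A b∈A s∈KA K+r≤N)
  where
  open ≡-Reasoning
  r : ℕ
  r = N ∸ (K + k)
  K+k+r≡N : (K + k) + r ≡ N
  K+k+r≡N = m+[n∸m]≡n K+k≤N
  K+r≤N : K + r ≤ N
  K+r≤N = subst (K + r ≤_) K+k+r≡N (+-monoˡ-≤ r (m≤m+n K k))
  distrib : ∀ K k c b → ((K + k) + c) * b ≡ K * b + (k * b + c * b)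
  distrib = ℕ-Ring.solve-∀
  shuffle : ∀ m s u v → (m + s) + (u + v) ≡ (s + v) + (m + u)
  shuffle = ℕ-Ring.solve-∀
  n≡s+rb : n ≡ s + r * b
  n≡s+rb = +-cancelʳ-≡ (m + k * b) n (s + r * b) (begin
    n + (m + k * b)           ≡⟨ n+m+kb≡Nb ⟩
    N * b                     ≡⟨ cong (_* b) (sym K+k+r≡N) ⟩
    ((K + k) + r) * b         ≡⟨ distrib K k r b ⟩
    K * b + (k * b + r * b)   ≡⟨ cong (_+ (k * b + r * b)) (sym m+s≡Kb) ⟩
    (m + s) + (k * b + r * b) ≡⟨ shuffle m s (k * b) (r * b) ⟩
    (s + r * b) + (m + k * b) ∎)

InSumset-split : .{{_ : NonZero b}} → 0 ∈ A → b ∈ A → (∀ {x} → x ∈ A → x ≤ b) →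
                 InSumset K A m → InSumset K′ (reflectList b A) m′ → K + K′ ≤ N →
                 ∀ {e} → ∃[ k ] n ≡ m + k * b → ∃[ k′ ] e ≡ m′ + k′ * b → n + e ≡ N * b →
                 InSumset N A n
InSumset-split {b = b} {K = K} {m = m} {K′ = K′} {m′ = m′} {N = N}
               0∈A b∈A A≤b m∈KA m′∈K′[b-A] K+K′≤N (k , refl) (k′ , refl) n+e≡Nb
  with m+n≤o⇒p+q≤o⇒m+p≤o⊎n+q≤o {K} {K′} {N} {k} {k′} K+K′≤N k+k′≤N
  where
  k+k′≤N : k + k′ ≤ N
  k+k′≤N = *-cancelʳ-≤ (k + k′) N b (begin
    (k + k′) * b                ≡⟨ *-distribʳ-+ b k k′ ⟩
    k * b + k′ * b              ≤⟨ +-mono-≤ (m≤n+m (k * b) m) (m≤n+m (k′ * b) m′) ⟩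
    (m + k * b) + (m′ + k′ * b) ≡⟨ n+e≡Nb ⟩
    N * b                       ∎)
    where open ≤-Reasoning
... | inj₁ K+k≤N   = InSumset-+b* 0∈A b∈A m∈KA K+k≤N
... | inj₂ K′+k′≤N = InSumset-complement 0∈A b∈A A≤b m′∈K′[b-A] K′+k′≤N n+e≡Nb

mainTheorem9 : (A : List ℕ) (b : ℕ) → Admissible A b →
    (N : ℕ) → 1 ≤ N →
    (∀ a → 1 ≤ a → a ≤ b ∸ 1 → ∀ K K' →
       IsNcount A b a K → IsNcount (reflectList b A) b (b ∸ a) K' → K + K' ≤ N) →
    (n : ℕ) → n ≤ N * b →
    ¬ InE A n →
    ¬ (Σ ℕ λ e → InE (reflectList b A) e × n + e ≡ N * b) →
    InSumset N A n
mainTheorem9 A b (1≤b , 0∈A , b∈A , A≤b , _) N _ N≥counts n n≤Nb n∉E Nb-n∉E =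
  decidable-stable (InSumset-dec A N n) (by-residue (n % b) (ModEq-% n) (m%n<n n b))
  where
  instance
    b≢0 : NonZero b
    b≢0 = >-nonZero 1≤b
  e : ℕ
  e = N * b ∸ n
  n+e≡Nb : n + e ≡ N * b
  n+e≡Nb = m+[n∸m]≡n n≤Nb
  by-residue : ∀ a → ModEq b n a → a < b → ¬ ¬ InSumset N A n
  by-residue zero n≡0 _ with ModEq⇒≡+* z≤n n≡0
  ... | k , n≡kb = pure (subst (InSumset N A) (sym n≡kb)
          (InSumset-+b* 0∈A b∈A ([] , [] , refl) (*-cancelʳ-≤ k N b (subst (_≤ N * b) n≡kb n≤Nb))))
  by-residue a@(suc _) n≡a a<b = do
    n∈P ← n∉E
    e∈P ← λ e∉P → Nb-n∉E (e , e∉P , n+e≡Nb)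
    let e≡b-a = ModEq-complement N (<⇒≤ a<b) n≤Nb n≡a
    (K , countA@(m , m-min , m∈KA , _)) ← ¬¬-IsNcount A a n≡a n∈P
    (K′ , countB@(m′ , m′-min , m′∈K′[b-A] , _)) ← ¬¬-IsNcount (reflectList b A) (b ∸ a) e≡b-a e∈P
    pure (InSumset-split 0∈A b∈A A≤b m∈KA m′∈K′[b-A]
            (N≥counts a (s≤s z≤n) (∸-monoˡ-≤ 1 a<b) K K′ countA countB)
            (IsNmin⇒≡+* A a m-min n≡a n∈P)
            (IsNmin⇒≡+* (reflectList b A) (b ∸ a) m′-min e≡b-a e∈P)
            n+e≡Nb)
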